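{- Let $I$ be an index set. For each $i \in I$, let $\mathbf X_i = (X_i, \le_i)$ be a poset and $E_i$ an equivalence relation on $X_i$ such that $\le_i\; \subseteq E_i$. Assume $X_i \cap X_j = \varnothing$ for all $i, j \in I$ with $i \neq j$. Suppose further that for each $i \in I$ the map $\alpha_i\colon X_i \to X_i$ is an order automorphism of $\mathbf X_i$ and $\beta_i\colon X_i \to X_i$ is a self-inverse dual order automorphism of $\mathbf X_i$ such that $\alpha_i, \beta_i \subseteq E_i$ and $\beta_i = \alpha_i \circ \beta_i \circ \alpha_i$. Then: (i) $(X, \le)$ is a poset and $E$ is an equivalence relation on $X$ such that $\le\; \subseteq E$; (ii) $\alpha$ is an order automorphism of $\mathbf X=(X,\le)$ such that $\alpha \subseteq E$; (iii) $\beta$ is a self-inverse dual order automorphism of $\mathbf X$ such that $\beta \subseteq E$; (iv) $\beta = \alpha \circ \beta \circ \alpha$; (v) $\mathbf{Dq}(\mathbf E) \cong \prod_{i \in I}\mathbf{Dq}(\mathbf E_i)$.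
   Context: Notation: $X := \bigcup_{i\in I}X_i$, $\le\; := \bigcup_{i\in I}\le_i$, $E := \bigcup_{i\in I}E_i$. Given maps $\gamma_i\colon X_i\to X_i$ ($i\in I$), $\gamma\colon X\to X$ is defined by $\gamma(x)=\gamma_i(x)$ if $x\in X_i$ (so $\gamma=\bigcup_{i\in I}\gamma_i$ as graphs); in particular $\alpha=\bigcup_i\alpha_i$ and $\beta=\bigcup_i\beta_i$. Maps are identified with their graphs $\{(x,\gamma(x))\}$; composition of relations is $R\circ S=\{(x,y)\mid \exists z\,((x,z)\in R,(z,y)\in S)\}$, $R^\smile$ is the converse and $R^c$ the complement (within the ambient equivalence relation). Construction $\mathbf{Dq}$: for a poset $(Y,\le)$, an equivalence relation $F$ on $Y$ with $\le\,\subseteq F$, an order automorphism $\alpha$ and a self-inverse dual order automorphism $\beta$ of $(Y,\le)$ with $\alpha,\beta\subseteq F$ and $\beta=\alpha\circ\beta\circ\alpha$, order $F$ by $(u,v)\preceq(x,y)$ iff $x\le u$ and $v\le y$, and let $\mathsf{Up}(\mathbf F)$ be the up-sets of $\mathbf F=(F,\preceq)$. Then $\mathbf{Dq}(\mathbf F)=\langle \mathsf{Up}(\mathbf F),\cap,\cup,\circ,1,0,\sim,-,'\rangle$ with $1=\;\le$, $0=\alpha\circ(\le^c)^\smile$, ${\sim}R=R\backslash 0=(R^\smile\circ 0^c)^c$, $-R=0/R=(0^c\circ R^\smile)^c$, and $R'=\alpha\circ\beta\circ R^c\circ\beta$; this is a distributive quasi relation algebra. Here $\mathbf{Dq}(\mathbf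 E_i)$ is built from $(X_i,\le_i),E_i,\alpha_i,\beta_i$ and $\mathbf{Dq}(\mathbf E)$ from $(X,\le),E,\alpha,\beta$. -}

module Defs where

open import Level using (Level; _⊔_) renaming (suc to lsuc)
open import Data.Product using (Σ; ∃; _×_; _,_; proj₁; proj₂)
open import Data.Sum using (_⊎_; inj₁; inj₂)
open import Relation.Nullary using (¬_)
open import Relation.Binary.PropositionalEquality using (_≡_; refl; sym; trans; subst)
open import Relation.Binary.Structures using (IsPartialOrder; IsEquivalence)
open import Function.Bundles using (_⇔_; Equivalence)
open import Function.Definitions using (Bijective)

BinRel : ∀ {ℓ} → Set ℓ → Set (lsuc ℓ)
BinRel {ℓ} Y = Y → Y → Set ℓ

module _ {ℓ} {Y : Set ℓ} where

  _⊆ᵣ_ : BinRel Y → BinRel Y → Set ℓ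
  R ⊆ᵣ S = ∀ {x y} → R x y → S x y

  _≐_ : BinRel Y → BinRel Y → Set ℓ
  R ≐ S = (R ⊆ᵣ S) × (S ⊆ᵣ R)

  infixl 7 _∘ᵣ_
  _∘ᵣ_ : BinRel Y → BinRel Y → BinRel Y
  (R ∘ᵣ S) x y = ∃ λ z → R x z × S z y

  _˘ : BinRel Y → BinRel Y
  (R ˘) x y = R y x

  compl : BinRel Y → BinRel Y → BinRel Y
  compl F R x y = F x y × ¬ R x y

  graph : (Y → Y) → BinRel Y
  graph f x y = f x ≡ y

  OrderAutomorphism : BinRel Y → (Y → Y) → Set ℓ
  OrderAutomorphism _≤_ f = Bijective _≡_ _≡_ f × (∀ x y → (x ≤ y) ⇔ (f x ≤ f y))

  DualOrderAutomorphism : BinRel Y → (Y → Y) → Set ℓ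
  DualOrderAutomorphism _≤_ f = Bijective _≡_ _≡_ f × (∀ x y → (x ≤ y) ⇔ (f y ≤ f x))

  SelfInverse : (Y → Y) → Set ℓ
  SelfInverse f = ∀ x → f (f x) ≡ x

record DqData (ℓ : Level) : Set (lsuc ℓ) where
  field
    Y   : Set ℓ
    _≤_ : BinRel Y
    F   : BinRel Y
    α   : Y → Y
    β   : Y → Y

record IsDqHyp {ℓ} (D : DqData ℓ) : Set ℓ where
  open DqData D
  field
    isPartialOrder : IsPartialOrder _≡_ _≤_
    F-equiv        : IsEquivalence F
    ≤⊆F            : _≤_ ⊆ᵣ F
    α-aut          : OrderAutomorphism _≤_ α
    β-dual         : DualOrderAutomorphism _≤_ β
    β-selfInverse  : SelfInverse β
    α⊆F            : graph α ⊆ᵣ F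
    β⊆F            : graph β ⊆ᵣ F
    β≐αβα          : graph β ≐ (graph α ∘ᵣ graph β ∘ᵣ graph α)

record DqAlg (c e : Level) : Set (lsuc (c ⊔ e)) where
  infixr 6 _∧_
  infixr 5 _∨_
  infixl 7 _·_
  field
    Carrier : Set c
    _≈_     : Carrier → Carrier → Set e
    _∧_ _∨_ _·_ : Carrier → Carrier → Carrier
    one zero : Carrier
    ∼_ -_ _′ : Carrier → Carrier

Π : ∀ {i c e} (I : Set i) → (I → DqAlg c e) → DqAlg (i ⊔ c) (i ⊔ e)
Π I A = record
  { Carrier = (k : I) → DqAlg.Carrier (A k)
  ; _≈_     = λ a b → (k : I) → DqAlg._≈_ (A k) (a k) (b k)
  ; _∧_     = λ a b k → DqAlg._∧_ (A k) (a k) (b k)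
  ; _∨_     = λ a b k → DqAlg._∨_ (A k) (a k) (b k)
  ; _·_     = λ a b k → DqAlg._·_ (A k) (a k) (b k)
  ; one     = λ k → DqAlg.one (A k)
  ; zero    = λ k → DqAlg.zero (A k)
  ; ∼_      = λ a k → DqAlg.∼_ (A k) (a k)
  ; -_      = λ a k → DqAlg.-_ (A k) (a k)
  ; _′      = λ a k → DqAlg._′ (A k) (a k)
  }

record Iso {c₁ e₁ c₂ e₂} (A : DqAlg c₁ e₁) (B : DqAlg c₂ e₂) : Set (c₁ ⊔ e₁ ⊔ c₂ ⊔ e₂) where
  private
    module A = DqAlg A
    module B = DqAlg B
  field
    to        : A.Carrier → B.Carrier
    from      : B.Carrier → A.Carrier
    to-cong   : ∀ {a a'} → a A.≈ a' → to a B.≈ to a'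
    from-cong : ∀ {b b'} → b B.≈ b' → from b A.≈ from b'
    to-from   : ∀ b → to (from b) B.≈ b
    from-to   : ∀ a → from (to a) A.≈ a
    hom-∧     : ∀ a b → to (a A.∧ b) B.≈ (to a B.∧ to b)
    hom-∨     : ∀ a b → to (a A.∨ b) B.≈ (to a B.∨ to b)
    hom-·     : ∀ a b → to (a A.· b) B.≈ (to a B.· to b)
    hom-one   : to A.one B.≈ B.one
    hom-zero  : to A.zero B.≈ B.zero
    hom-∼     : ∀ a → to (A.∼ a) B.≈ (B.∼ to a)
    hom--     : ∀ a → to (A.- a) B.≈ (B.- to a)
    hom-′     : ∀ a → to (a A.′) B.≈ (to a B.′)

module DqConstruction {ℓ} (D : DqData ℓ) (H : IsDqHyp D) where
  open DqData D
  open IsDqHyp H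
  private
    module PO = IsPartialOrder isPartialOrder
    module FE = IsEquivalence F-equiv

  -- (u,v) ⪯ (x,y)  iff  x ≤ u and v ≤ y   (for pairs in F)
  -- up-sets of (F, ⪯)
  record Up : Set (lsuc ℓ) where
    field
      rel   : BinRel Y
      rel⊆F : rel ⊆ᵣ F
      upward : ∀ {u v x y} → rel u v → F x y → x ≤ u → v ≤ y → rel x y
  open Up

  _≈U_ : Up → Up → Set ℓ
  R ≈U S = rel R ≐ rel S

  oneR zeroR : BinRel Y
  oneR = _≤_
  zeroR = graph α ∘ᵣ (compl F _≤_) ˘

  ∼R -R ′R : BinRel Y → BinRel Y
  ∼R R = compl F ((R ˘) ∘ᵣ compl F zeroR)          -- R \ 0
  -R R = compl F (compl F zeroR ∘ᵣ (R ˘))          -- 0 / R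
  ′R R = graph α ∘ᵣ graph β ∘ᵣ compl F R ∘ᵣ graph β

  private
    α-mono : ∀ {x y} → x ≤ y → α x ≤ α y
    α-mono {x} {y} = Equivalence.to (proj₂ α-aut x y)
    β-anti : ∀ {x y} → x ≤ y → β y ≤ β x
    β-anti {x} {y} = Equivalence.to (proj₂ β-dual x y)
    Fα : ∀ x → F x (α x)
    Fα x = α⊆F refl
    Fβ : ∀ x → F x (β x)
    Fβ x = β⊆F refl

  ∧U ∨U ·U : Up → Up → Up
  ∧U R S = record
    { rel = λ x y → rel R x y × rel S x y
    ; rel⊆F = λ p → rel⊆F R (proj₁ p)
    ; upward = λ p f a b → upward R (proj₁ p) f a b , upward S (proj₂ p) f a b }
  ∨U R S = record
    { rel = λ x y → rel R x y ⊎ rel S x y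
    ; rel⊆F = λ { (inj₁ p) → rel⊆F R p ; (inj₂ p) → rel⊆F S p }
    ; upward = λ { (inj₁ p) f a b → inj₁ (upward R p f a b)
                 ; (inj₂ p) f a b → inj₂ (upward S p f a b) } }
  ·U R S = record
    { rel = rel R ∘ᵣ rel S
    ; rel⊆F = λ { (z , p , q) → FE.trans (rel⊆F R p) (rel⊆F S q) }
    ; upward = λ { {u} {v} {x} {y} (w , p , q) f a b →
        w , upward R p (FE.trans (≤⊆F a) (rel⊆F R p)) a PO.refl
          , upward S q (FE.trans (rel⊆F S q) (≤⊆F b)) PO.refl b } }

  oneU : Up
  oneU = record
    { rel = oneR
    ; rel⊆F = ≤⊆F
    ; upward = λ p f a b → PO.trans a (PO.trans p b) }

  zeroU : Up
  zeroU = record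
    { rel = zeroR
    ; rel⊆F = λ { {x} (._ , refl , fyz , _) → FE.trans (Fα x) (FE.sym fyz) }
    ; upward = λ { {u} {v} {x} {y} (._ , refl , fvz , nvz) f a b →
        α x , refl , FE.trans (FE.sym f) (Fα x)
            , λ yαx → nvz (PO.trans b (PO.trans yαx (α-mono a))) } }

  ∼U : Up → Up
  ∼U R = record
    { rel = ∼R (rel R)
    ; rel⊆F = proj₁
    ; upward = λ { {u} {v} {x} {y} (fuv , n) f a b →
        f , λ { (z , rzx , fzy , n0) →
          n (z , upward R rzx (FE.trans (rel⊆F R rzx) (≤⊆F a)) PO.refl a
               , FE.trans fzy (FE.sym (≤⊆F b))
               , λ z0v → n0 (Up.upward zeroU z0v fzy PO.refl b)) } } }

  -U : Up → Up
  -U R = record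
    { rel = -R (rel R)
    ; rel⊆F = proj₁
    ; upward = λ { {u} {v} {x} {y} (fuv , n) f a b →
        f , λ { (z , (fxz , n0) , ryz) →
          n (z , (FE.trans (FE.sym (≤⊆F a)) fxz
                 , λ u0z → n0 (Up.upward zeroU u0z fxz a PO.refl))
               , upward R ryz (FE.trans (≤⊆F b) (rel⊆F R ryz)) b PO.refl) } } }

  ′U : Up → Up
  ′U R = record
    { rel = ′R (rel R)
    ; rel⊆F = λ { {x} (w , (._ , (._ , refl , refl) , fw , _) , refl) →
        FE.trans (Fα x) (FE.trans (Fβ (α x)) (FE.trans fw (Fβ w))) }
    ; upward = λ { {u} {v} {x} {y} (w , (._ , (._ , refl , refl) , fw , nr) , refl) f a b →
        β y , (β (α x) , (α x , refl , refl)
              , FE.trans (FE.sym (Fβ (α x))) (FE.trans (FE.sym (Fα x)) (FE.trans f (Fβ y)))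
              , λ r → nr (upward R r fw (β-anti (α-mono a))
                           (subst (β y ≤_) (β-selfInverse w) (β-anti b))))
        , β-selfInverse y } }

  algebra : DqAlg (lsuc ℓ) ℓ
  algebra = record
    { Carrier = Up ; _≈_ = _≈U_
    ; _∧_ = ∧U ; _∨_ = ∨U ; _·_ = ·U
    ; one = oneU ; zero = zeroU
    ; ∼_ = ∼U ; -_ = -U ; _′ = ′U }

Dq : ∀ {ℓ} (D : DqData ℓ) → IsDqHyp D → DqAlg (lsuc ℓ) ℓ
Dq D H = DqConstruction.algebra D H

-- Unions of pairwise disjoint families.  The pairwise disjoint sets X_i
-- are realised as the summands of the disjoint union Σ I X_i.

module _ {ℓ} {I : Set ℓ} {X : I → Set ℓ} where

  data ⋃Rel (R : (i : I) → BinRel (X i)) : BinRel (Σ I X) where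
    inj : ∀ {i x y} → R i x y → ⋃Rel R (i , x) (i , y)

  ⋃Map : ((i : I) → X i → X i) → Σ I X → Σ I X
  ⋃Map γ (i , x) = i , γ i x

⋃D : ∀ {ℓ} {I : Set ℓ} → (I → DqData ℓ) → DqData ℓ
⋃D {I = I} D = record
  { Y   = Σ I (λ i → DqData.Y (D i))
  ; _≤_ = ⋃Rel (λ i → DqData._≤_ (D i))
  ; F   = ⋃Rel (λ i → DqData.F (D i))
  ; α   = ⋃Map (λ i → DqData.α (D i))
  ; β   = ⋃Map (λ i → DqData.β (D i)) }

-- Every relation involved relates only points of the same summand X_i, so an up-set of
-- (E, ⪯) is the disjoint union of its restrictions to the summands, and restriction to a
-- summand commutes with intersection, union, composition, converse, relative complement
-- and the graphs of α and β.  Hence R ↦ (R ↾ i)_i is an isomorphism Dq(E) ≅ Π_i Dq(E_i),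
-- with inverse (R_i)_i ↦ ⋃_i R_i.  The hypotheses (i)–(iv) on ⋃_i hold because they hold componentwise.
module Submission where

open import Defs
open import Data.Product using (Σ; ∃; _,_; proj₁; proj₂)
open import Function using (_∘_)
open import Relation.Binary.PropositionalEquality using (_≡_; refl; sym; trans; cong)
open import Relation.Binary.Structures using (IsPartialOrder; IsEquivalence)
open import Function.Bundles using (_⇔_; mk⇔; Equivalence)
open import Function.Definitions using (Bijective)

module _ {ℓ} {Y : Set ℓ} where

  ≐-refl : {R : BinRel Y} → R ≐ R
  ≐-refl = (λ p → p) , (λ p → p)

  ≐-sym : {R S : BinRel Y} → R ≐ S → S ≐ R
  ≐-sym (f , g) = g , f

  ≐-trans : {R S T : BinRel Y} → R ≐ S → S ≐ T → R ≐ T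
  ≐-trans (f , g) (f′ , g′) = f′ ∘ f , g ∘ g′

  ∘ᵣ-cong : {R R′ S S′ : BinRel Y} → R ≐ R′ → S ≐ S′ → (R ∘ᵣ S) ≐ (R′ ∘ᵣ S′)
  ∘ᵣ-cong (f , g) (f′ , g′) =
    (λ (z , r , s) → z , f r , f′ s) , (λ (z , r , s) → z , g r , g′ s)

  ˘-cong : {R S : BinRel Y} → R ≐ S → (R ˘) ≐ (S ˘)
  ˘-cong (f , g) = f , g

  compl-cong : {A A′ R R′ : BinRel Y} → A ≐ A′ → R ≐ R′ → compl A R ≐ compl A′ R′
  compl-cong (f , g) (f′ , g′) =
    (λ (a , n) → f a , n ∘ g′) , (λ (a , n) → g a , n ∘ f′)

  graph-∘ᵣ : (f g : Y → Y) → (graph f ∘ᵣ graph g) ≐ graph (g ∘ f)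
  graph-∘ᵣ f g = (λ { (_ , refl , refl) → refl }) , (λ { refl → f _ , refl , refl })

  graph-≐ : {f g : Y → Y} → (∀ x → f x ≡ g x) → graph f ≐ graph g
  graph-≐ f≡g = (λ {x} e → trans (sym (f≡g x)) e) , (λ {x} e → trans (f≡g x) e)

  ≐graph⇒≡ : {f g : Y → Y} → graph f ≐ graph g → ∀ x → f x ≡ g x
  ≐graph⇒≡ (f⊆g , _) x = sym (f⊆g refl)

  graph≐αβα⇔ : (α β : Y → Y) →
    (graph β ≐ (graph α ∘ᵣ graph β ∘ᵣ graph α)) ⇔ (∀ x → β x ≡ α (β (α x)))
  graph≐αβα⇔ α β = mk⇔
    (λ e → ≐graph⇒≡ (≐-trans e αβα≐))
    (λ e → ≐-trans (graph-≐ e) (≐-sym αβα≐))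
    where
    αβα≐ : (graph α ∘ᵣ graph β ∘ᵣ graph α) ≐ graph (α ∘ β ∘ α)
    αβα≐ = ≐-trans (∘ᵣ-cong (graph-∘ᵣ α β) ≐-refl) (graph-∘ᵣ (β ∘ α) α)

module _ {ℓ} {I : Set ℓ} {X : I → Set ℓ} where

  infixl 8 _↾_
  _↾_ : BinRel (Σ I X) → (k : I) → BinRel (X k)
  (R ↾ k) x y = R (k , x) (k , y)

  ↾-cong : {R S : BinRel (Σ I X)} → R ≐ S → ∀ k → (R ↾ k) ≐ (S ↾ k)
  ↾-cong (f , g) k = f , g

  ⋃Rel-cong : {R S : (i : I) → BinRel (X i)} → (∀ i → R i ≐ S i) → ⋃Rel R ≐ ⋃Rel S
  ⋃Rel-cong R≐S = (λ { (inj p) → inj (proj₁ (R≐S _) p) }) , (λ { (inj p) → inj (proj₂ (R≐S _) p) })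

  ⋃Rel-↾ : (R : (i : I) → BinRel (X i)) → ∀ k → (⋃Rel R ↾ k) ≐ R k
  ⋃Rel-↾ R k = (λ { (inj p) → p }) , inj

  ⋃Rel-˘ : {R : (i : I) → BinRel (X i)} → (⋃Rel R ˘) ⊆ᵣ ⋃Rel (λ i → R i ˘)
  ⋃Rel-˘ (inj p) = inj p

  ⊆⋃Rel⇒≐⋃Rel↾ : {R : BinRel (Σ I X)} {E : (i : I) → BinRel (X i)} →
    R ⊆ᵣ ⋃Rel E → R ≐ ⋃Rel (R ↾_)
  ⊆⋃Rel⇒≐⋃Rel↾ {R} R⊆E = split , (λ { (inj p) → p })
    where
    split : R ⊆ᵣ ⋃Rel (R ↾_)
    split p with R⊆E p
    ... | inj _ = inj p

  -- Only the right factor needs to stay within summands: it forces the middle point into X_k.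
  ↾-∘ᵣ : (R S : BinRel (Σ I X)) {E : (i : I) → BinRel (X i)} →
    S ⊆ᵣ ⋃Rel E → ∀ k → ((R ∘ᵣ S) ↾ k) ≐ (R ↾ k ∘ᵣ S ↾ k)
  ↾-∘ᵣ R S S⊆E k = forth , (λ (z , r , s) → (k , z) , r , s)
    where
    forth : ((R ∘ᵣ S) ↾ k) ⊆ᵣ (R ↾ k ∘ᵣ S ↾ k)
    forth (z , r , s) with S⊆E s
    ... | inj _ = _ , r , s

  graph-⋃Map-↾ : (γ : (i : I) → X i → X i) → ∀ k → (graph (⋃Map γ) ↾ k) ≐ graph (γ k)
  graph-⋃Map-↾ γ k = (λ { refl → refl }) , (λ { refl → refl })

  graph-⋃Map-⊆ : {γ : (i : I) → X i → X i} {E : (i : I) → BinRel (X i)} →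
    (∀ i → graph (γ i) ⊆ᵣ E i) → graph (⋃Map γ) ⊆ᵣ ⋃Rel E
  graph-⋃Map-⊆ γ⊆E {_ , _} refl = inj (γ⊆E _ refl)

  ⋃Rel-isEquivalence : {E : (i : I) → BinRel (X i)} →
    (∀ i → IsEquivalence (E i)) → IsEquivalence (⋃Rel E)
  ⋃Rel-isEquivalence eq = record
    { refl  = λ { {_ , _} → inj (IsEquivalence.refl (eq _)) }
    ; sym   = λ { (inj p) → inj (IsEquivalence.sym (eq _) p) }
    ; trans = λ { (inj p) (inj q) → inj (IsEquivalence.trans (eq _) p q) } }

  ⋃Rel-isPartialOrder : {R : (i : I) → BinRel (X i)} →
    (∀ i → IsPartialOrder _≡_ (R i)) → IsPartialOrder _≡_ (⋃Rel R)
  ⋃Rel-isPartialOrder po = record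
    { isPreorder = record
      { isEquivalence = record { refl = refl ; sym = sym ; trans = trans }
      ; reflexive = λ { {_ , _} refl → inj (IsPartialOrder.refl (po _)) }
      ; trans = λ { (inj p) (inj q) → inj (IsPartialOrder.trans (po _) p q) } }
    ; antisym = λ { (inj p) (inj q) → cong (_ ,_) (IsPartialOrder.antisym (po _) p q) } }

  ⋃Map-cong : {f g : (i : I) → X i → X i} → (∀ i x → f i x ≡ g i x) → ∀ p → ⋃Map f p ≡ ⋃Map g p
  ⋃Map-cong f≡g (i , x) = cong (i ,_) (f≡g i x)

  ⋃Map-bijective : {γ : (i : I) → X i → X i} →
    (∀ i → Bijective _≡_ _≡_ (γ i)) → Bijective _≡_ _≡_ (⋃Map γ)
  ⋃Map-bijective {γ} bij = injective , surjective
    where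
    γ⁻¹ : (i : I) → X i → X i
    γ⁻¹ i y = proj₁ (proj₂ (bij i) y)

    γγ⁻¹ : ∀ i y → γ i (γ⁻¹ i y) ≡ y
    γγ⁻¹ i y = proj₂ (proj₂ (bij i) y) refl

    γ⁻¹γ : ∀ p → ⋃Map γ⁻¹ (⋃Map γ p) ≡ p
    γ⁻¹γ (i , x) = cong (i ,_) (proj₁ (bij i) (γγ⁻¹ i (γ i x)))

    injective : ∀ {p q} → ⋃Map γ p ≡ ⋃Map γ q → p ≡ q
    injective {p} {q} e = trans (sym (γ⁻¹γ p)) (trans (cong (⋃Map γ⁻¹) e) (γ⁻¹γ q))

    surjective : ∀ y → ∃ λ x → ∀ {z} → z ≡ x → ⋃Map γ z ≡ y
    surjective (i , y) = (i , γ⁻¹ i y) , λ { refl → cong (i ,_) (γγ⁻¹ i y) }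

  ⋃Map-⇔ : {R S : (i : I) → BinRel (X i)} {γ : (i : I) → X i → X i} →
    (∀ i x y → R i x y ⇔ S i (γ i x) (γ i y)) →
    ∀ p q → ⋃Rel R p q ⇔ ⋃Rel S (⋃Map γ p) (⋃Map γ q)
  ⋃Map-⇔ R⇔S (i , x) (_ , y) = mk⇔
    (λ { (inj r) → inj (Equivalence.to (R⇔S i x y) r) })
    (λ { (inj s) → inj (Equivalence.from (R⇔S i x y) s) })

  ⋃Map-⇔˘ : {R S : (i : I) → BinRel (X i)} {γ : (i : I) → X i → X i} →
    (∀ i x y → R i x y ⇔ S i (γ i y) (γ i x)) →
    ∀ p q → ⋃Rel R p q ⇔ ⋃Rel S (⋃Map γ q) (⋃Map γ p)
  ⋃Map-⇔˘ R⇔S (i , x) (_ , y) = mk⇔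
    (λ { (inj r) → inj (Equivalence.to (R⇔S i x y) r) })
    (λ { (inj s) → inj (Equivalence.from (R⇔S i x y) s) })

⋃-isDqHyp : ∀ {ℓ} {I : Set ℓ} {D : I → DqData ℓ} → (∀ i → IsDqHyp (D i)) → IsDqHyp (⋃D D)
⋃-isDqHyp {D = D} H = record
  { isPartialOrder = ⋃Rel-isPartialOrder (IsDqHyp.isPartialOrder ∘ H)
  ; F-equiv        = ⋃Rel-isEquivalence (IsDqHyp.F-equiv ∘ H)
  ; ≤⊆F            = λ { (inj p) → inj (IsDqHyp.≤⊆F (H _) p) }
  ; α-aut          = ⋃Map-bijective (proj₁ ∘ IsDqHyp.α-aut ∘ H)
                   , ⋃Map-⇔ (λ i x y → proj₂ (IsDqHyp.α-aut (H i)) x y)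
  ; β-dual         = ⋃Map-bijective (proj₁ ∘ IsDqHyp.β-dual ∘ H)
                   , ⋃Map-⇔˘ (λ i x y → proj₂ (IsDqHyp.β-dual (H i)) x y)
  ; β-selfInverse  = ⋃Map-cong (IsDqHyp.β-selfInverse ∘ H)
  ; α⊆F            = graph-⋃Map-⊆ (λ i → IsDqHyp.α⊆F (H i))
  ; β⊆F            = graph-⋃Map-⊆ (λ i → IsDqHyp.β⊆F (H i))
  ; β≐αβα          = Equivalence.from (graph≐αβα⇔ (DqData.α (⋃D D)) (DqData.β (⋃D D)))
      (⋃Map-cong (λ i → Equivalence.to (graph≐αβα⇔ _ _) (IsDqHyp.β≐αβα (H i)))) }

module Restriction {ℓ} {I : Set ℓ} (D : I → DqData ℓ) (H : ∀ i → IsDqHyp (D i)) where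
  private
    module U = DqConstruction (⋃D D) (⋃-isDqHyp H)
    module C (k : I) = DqConstruction (D k) (H k)
    open DqData using (_≤_; F; α; β)
    ⋃F ⋃≤ gα gβ : BinRel (DqData.Y (⋃D D))
    ⋃F = DqData.F (⋃D D)
    ⋃≤ = DqData._≤_ (⋃D D)
    gα = graph (DqData.α (⋃D D))
    gβ = graph (DqData.β (⋃D D))

    F↾ : ∀ k → (⋃F ↾ k) ≐ F (D k)
    F↾ = ⋃Rel-↾ (F ∘ D)

    gβ⊆⋃F : gβ ⊆ᵣ ⋃F
    gβ⊆⋃F = graph-⋃Map-⊆ (λ i → IsDqHyp.β⊆F (H i))

  restrictUp : U.Up → (k : I) → C.Up k
  restrictUp R k = record
    { rel    = U.Up.rel R ↾ k
    ; rel⊆F  = λ p → proj₁ (F↾ k) (U.Up.rel⊆F R p)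
    ; upward = λ p f a b → U.Up.upward R p (inj f) (inj a) (inj b) }

  ⋃Up : ((k : I) → C.Up k) → U.Up
  ⋃Up R = record
    { rel    = ⋃Rel (C.Up.rel ∘ R)
    ; rel⊆F  = λ { (inj p) → inj (C.Up.rel⊆F (R _) p) }
    ; upward = λ { (inj p) (inj f) (inj a) (inj b) → inj (C.Up.upward (R _) p f a b) } }

  zeroR-↾ : ∀ k → (U.zeroR ↾ k) ≐ C.zeroR k
  zeroR-↾ k = ≐-trans (↾-∘ᵣ gα ((compl ⋃F ⋃≤) ˘) (⋃Rel-˘ ∘ proj₁) k)
    (∘ᵣ-cong (graph-⋃Map-↾ (α ∘ D) k) (˘-cong (compl-cong (F↾ k) (⋃Rel-↾ (_≤_ ∘ D) k))))

  ∼R-↾ : ∀ R k → (U.∼R R ↾ k) ≐ C.∼R k (R ↾ k)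
  ∼R-↾ R k = compl-cong (F↾ k) (≐-trans (↾-∘ᵣ (R ˘) (compl ⋃F U.zeroR) proj₁ k)
    (∘ᵣ-cong ≐-refl (compl-cong (F↾ k) (zeroR-↾ k))))

  -R-↾ : ∀ R → R ⊆ᵣ ⋃F → ∀ k → (U.-R R ↾ k) ≐ C.-R k (R ↾ k)
  -R-↾ R R⊆F k = compl-cong (F↾ k) (≐-trans (↾-∘ᵣ (compl ⋃F U.zeroR) (R ˘) (⋃Rel-˘ ∘ R⊆F) k)
    (∘ᵣ-cong (compl-cong (F↾ k) (zeroR-↾ k)) ≐-refl))

  ′R-↾ : ∀ R k → (U.′R R ↾ k) ≐ C.′R k (R ↾ k)
  ′R-↾ R k =
    ≐-trans (↾-∘ᵣ (gα ∘ᵣ gβ ∘ᵣ compl ⋃F R) gβ gβ⊆⋃F k)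
      (∘ᵣ-cong (≐-trans (↾-∘ᵣ (gα ∘ᵣ gβ) (compl ⋃F R) proj₁ k)
        (∘ᵣ-cong (≐-trans (↾-∘ᵣ gα gβ gβ⊆⋃F k) (∘ᵣ-cong (graph-⋃Map-↾ (α ∘ D) k) gβ↾))
                 (compl-cong (F↾ k) ≐-refl)))
        gβ↾)
    where
    gβ↾ : (gβ ↾ k) ≐ graph (β (D k))
    gβ↾ = graph-⋃Map-↾ (β ∘ D) k

  ⋃Dq≅ΠDq : Iso (Dq (⋃D D) (⋃-isDqHyp H)) (Π I (λ i → Dq (D i) (H i)))
  ⋃Dq≅ΠDq = record
    { to        = restrictUp
    ; from      = ⋃Up
    ; to-cong   = ↾-cong
    ; from-cong = ⋃Rel-cong
    ; to-from   = λ R → ⋃Rel-↾ (C.Up.rel ∘ R)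
    ; from-to   = λ R → ≐-sym (⊆⋃Rel⇒≐⋃Rel↾ (U.Up.rel⊆F R))
    ; hom-∧     = λ _ _ _ → ≐-refl
    ; hom-∨     = λ _ _ _ → ≐-refl
    ; hom-·     = λ R S → ↾-∘ᵣ (U.Up.rel R) (U.Up.rel S) (U.Up.rel⊆F S)
    ; hom-one   = ⋃Rel-↾ (_≤_ ∘ D)
    ; hom-zero  = zeroR-↾
    ; hom-∼     = λ R → ∼R-↾ (U.Up.rel R)
    ; hom--     = λ R → -R-↾ (U.Up.rel R) (U.Up.rel⊆F R)
    ; hom-′     = λ R → ′R-↾ (U.Up.rel R) }

theorem4p1 : ∀ {ℓ} (I : Set ℓ) (D : I → DqData ℓ) (H : (i : I) → IsDqHyp (D i))
    → Σ (IsDqHyp (⋃D D)) (λ H⋃ → Iso (Dq (⋃D D) H⋃) (Π I (λ i → Dq (D i) (H i))))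
theorem4p1 I D H = ⋃-isDqHyp H , Restriction.⋃Dq≅ΠDq D H
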